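{- Let $\alpha$ be a prenaming with relaxed core $\{x_1,\dots,x_n\}$ and $\alpha(x_i)=y_i$, and let $\alpha_{inv}$ be the prenaming with relaxed core $\{y_1,\dots,y_n\}$ and $\alpha_{inv}(y_i)=x_i$ (identity elsewhere). Then $\overline{\alpha_{inv}}=\overline{\alpha}^{ -1}$.
   Context: A substitution maps variables to terms and is the identity outside the finite set $\mathrm{Dom}(\sigma)=\{x:\sigma(x)\neq x\}$. A renaming is a bijective substitution mapping variables to variables. A prenaming is a substitution $\alpha$ mapping variables to variables together with a fixed finite set $C^+(\alpha)\supseteq\mathrm{Dom}(\alpha)$ (relaxed core) on which $\alpha$ is injective; $R^+(\alpha)=\alpha(C^+(\alpha))$. The closure $\overline{\alpha}$ (a renaming) is defined by: $\overline{\alpha}(x)=\alpha(x)$ for $x\in C^+(\alpha)$; for $x\in R^+(\alpha)\setminus C^+(\alpha)$, $\overline{\alpha}(x)=z$ where $z$ is the start of the maximal chain $z,\alpha(z),\dots,\alpha^m(z)=x$ with $z,\dots,\alpha^{m-1}(z)\in C^+(\alpha)$; and $\overline{\alpha}(x)=x$ outside $C^+(\alpha)\cup R^+(\alpha)$. -}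

module Defs where

open import Data.Nat using (ℕ; zero; suc; _≟_)
open import Data.List using (List; []; _∷_; map; length)
open import Data.List.Membership.Propositional using (_∈_; _∉_)
open import Data.List.Membership.DecPropositional _≟_ using (_∈?_)
open import Data.Maybe using (Maybe; just; nothing)
open import Relation.Binary.PropositionalEquality using (_≡_)
open import Relation.Nullary using (yes; no)

-- Variables are natural numbers (a countably infinite set with decidable equality).
Var : Set
Var = ℕ

-- A prenaming: a variable-to-variable substitution α together with a finite
-- relaxed core C⁺(α) (given as a list) with Dom(α) ⊆ C⁺(α) and α injective on C⁺(α).
record Prenaming : Set where
  field
    fn     : Var → Var
    core   : List Var
    dom⊆core : ∀ x → x ∉ core → fn x ≡ x
    injOnCore : ∀ x y → x ∈ core → y ∈ core → fn x ≡ fn y → x ≡ y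

open Prenaming public

range : Prenaming → List Var
range α = map (fn α) (core α)

preimageIn : (Var → Var) → List Var → Var → Maybe Var
preimageIn f [] x = nothing
preimageIn f (c ∷ cs) x with f c ≟ x
... | yes _ = just c
... | no _  = preimageIn f cs x

walkBack : (Var → Var) → List Var → ℕ → Var → Var
walkBack f cs zero z = z
walkBack f cs (suc k) z with preimageIn f cs z
... | nothing = z
... | just w  = walkBack f cs k w

-- The closure ᾱ of a prenaming α.
-- * x ∈ C⁺(α):               ᾱ(x) = α(x)
-- * x ∈ R⁺(α) ∖ C⁺(α):       ᾱ(x) = start z of the maximal chain z, α z, …, α^m z = x
--                            with z,…,α^{m-1} z ∈ C⁺(α)  (m ≤ |C⁺(α)| by injectivity)
-- * otherwise:               ᾱ(x) = x
closure : Prenaming → Var → Var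
closure α x with x ∈? core α
... | yes _ = fn α x
... | no _ with x ∈? range α
...   | yes _ = walkBack (fn α) (core α) (length (core α)) x
...   | no _  = x

module Submission where

-- Write f = α, g = αinv, C = C⁺(α), D = C⁺(αinv).  The hypotheses
-- say D = f(C) and g ∘ f = id on C; hence also C = g(D) and f ∘ g = id on D,
-- so the situation is symmetric and it suffices to prove closure g ∘ closure f
-- = id.  Cases on x:
--  * x ∈ C: both closures act as f and g.
--  * x ∉ C ∪ f(C): then x ∉ D ∪ g(D) as well, and both closures fix x.
--  * x ∈ f(C) ∖ C: closure f walks back along the f-chain z, f z, …, x to its
--    start z, which lies in C but has no f-preimage in C, i.e. z ∈ g(D) ∖ D.
--    The g-preimage in D of each chain element w ∈ C is exactly f w, so the
--    backward g-walk from z retraces the chain forwards and stops at x ∉ C.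

open import Defs
open import Data.Nat using (ℕ; zero; suc; _+_; _∸_; _≤_; _<_; _≤?_; z≤n; s≤s; _≟_)
open import Data.Nat.Properties
  using (+-suc; +-identityʳ; +-monoˡ-<; m+[n∸m]≡n; <⇒≤; ≰⇒>; 1+n≰n)
open import Data.List using (List; []; _∷_; map; length)
open import Data.List.Properties using (length-map)
open import Data.List.Membership.Propositional using (_∈_; _∉_)
open import Data.List.Membership.DecPropositional _≟_ using (_∈?_)
open import Data.List.Membership.Propositional.Properties using (∈-map⁺; ∈-map⁻)
open import Data.List.Membership.Setoid.Properties using (index-injective)
open import Data.List.Relation.Unary.Any using (here; there; index)
open import Data.Fin using (Fin; toℕ)
open import Data.Fin.Properties using (pigeonhole; toℕ<n)
open import Data.Maybe using (just; nothing)
open import Data.Product using (Σ; _×_; _,_)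
open import Data.Empty using (⊥-elim)
open import Relation.Nullary using (Dec; yes; no)
open import Relation.Binary.PropositionalEquality

closure-core : ∀ α x → x ∈ core α → closure α x ≡ fn α x
closure-core α x x∈C with x ∈? core α
... | yes _   = refl
... | no x∉C = ⊥-elim (x∉C x∈C)

closure-range : ∀ α x → x ∉ core α → x ∈ range α →
  closure α x ≡ walkBack (fn α) (core α) (length (core α)) x
closure-range α x x∉C x∈R with x ∈? core α
... | yes x∈C = ⊥-elim (x∉C x∈C)
... | no _ with x ∈? range α
...   | yes _   = refl
...   | no x∉R = ⊥-elim (x∉R x∈R)

closure-outside : ∀ α x → x ∉ core α → x ∉ range α → closure α x ≡ x
closure-outside α x x∉C x∉R with x ∈? core α
... | yes x∈C = ⊥-elim (x∉C x∈C)
... | no _ with x ∈? range α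
...   | yes x∈R = ⊥-elim (x∉R x∈R)
...   | no _     = refl

NoPreimage : (Var → Var) → List Var → Var → Set
NoPreimage f cs z = ∀ c → c ∈ cs → f c ≢ z

preimageIn-sound : ∀ f cs x {c} → preimageIn f cs x ≡ just c → c ∈ cs × f c ≡ x
preimageIn-sound f (d ∷ cs) x e with f d ≟ x
... | yes fd≡x with e
...   | refl = here refl , fd≡x
preimageIn-sound f (d ∷ cs) x e | no _ =
  let c∈cs , fc≡x = preimageIn-sound f cs x e in there c∈cs , fc≡x

preimageIn-complete : ∀ f cs x → preimageIn f cs x ≡ nothing → NoPreimage f cs x
preimageIn-complete f (d ∷ cs) x e c c∈ fc≡x with f d ≟ x
preimageIn-complete f (d ∷ cs) x () c c∈ fc≡x | yes _
preimageIn-complete f (d ∷ cs) x e c (here refl) fc≡x | no fd≢x = fd≢x fc≡x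
preimageIn-complete f (d ∷ cs) x e c (there c∈cs) fc≡x | no _ =
  preimageIn-complete f cs x e c c∈cs fc≡x

walkBack-stop : ∀ f cs k z → NoPreimage f cs z → walkBack f cs k z ≡ z
walkBack-stop f cs zero z _ = refl
walkBack-stop f cs (suc k) z noPre with preimageIn f cs z in e
... | nothing = refl
... | just c  = let c∈cs , fc≡z = preimageIn-sound f cs z e in ⊥-elim (noPre c c∈cs fc≡z)

walkBack-step : ∀ f cs k z c → c ∈ cs → f c ≡ z →
  (∀ c′ → c′ ∈ cs → f c′ ≡ z → c′ ≡ c) →
  walkBack f cs (suc k) z ≡ walkBack f cs k c
walkBack-step f cs k z c c∈cs fc≡z unique with preimageIn f cs z in e
... | nothing = ⊥-elim (preimageIn-complete f cs z e c c∈cs fc≡z)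
... | just c′ = let c′∈cs , fc′≡z = preimageIn-sound f cs z e in
  cong (walkBack f cs k) (unique c′ c′∈cs fc′≡z)

iter : (Var → Var) → ℕ → Var → Var
iter f zero    w = w
iter f (suc m) w = iter f m (f w)

iter-+ : ∀ f a b z → iter f (a + b) z ≡ iter f b (iter f a z)
iter-+ f zero    b z = refl
iter-+ f (suc a) b z = iter-+ f a b (f z)

module Chains (f : Var → Var) (C : List Var) where

  record Chain (z : Var) (m : ℕ) (x : Var) : Set where
    field
      ends   : iter f m z ≡ x
      inside : ∀ j → j < m → iter f j z ∈ C
  open Chain public

  trivialChain : ∀ x → Chain x 0 x
  trivialChain x = record { ends = refl ; inside = λ _ () }

  extend : ∀ {w d x} c → Chain w d x → c ∈ C → f c ≡ w → Chain c (suc d) x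
  extend {d = d} c ch c∈C fc≡w = record
    { ends   = trans (cong (iter f d) fc≡w) (ends ch)
    ; inside = λ { zero _ → c∈C
                 ; (suc j) (s≤s j<d) → subst (λ v → iter f j v ∈ C) (sym fc≡w) (inside ch j j<d) } }

  head : ∀ {z m x} → Chain z (suc m) x → z ∈ C
  head ch = inside ch 0 (s≤s z≤n)

  tail : ∀ {z m x} → Chain z (suc m) x → Chain (f z) m x
  tail ch = record { ends = ends ch ; inside = λ j j<m → inside ch (suc j) (s≤s j<m) }

  -- A chain ending outside C never revisits a point: a repetition f^i z = f^j z
  -- with i < j < m would make x = f^{i + (m ∸ j)} z an element of C.
  chain-injective : ∀ {z m x} → x ∉ C → Chain z m x →
    ∀ i j → i < j → j < m → iter f i z ≢ iter f j z
  chain-injective {z} {m} {x} x∉C ch i j i<j j<m fi≡fj =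
    x∉C (subst (_∈ C) reachesX (inside ch (i + r) (subst (i + r <_) j+r≡m (+-monoˡ-< r i<j))))
    where
    r : ℕ
    r = m ∸ j
    j+r≡m : j + r ≡ m
    j+r≡m = m+[n∸m]≡n (<⇒≤ j<m)
    reachesX : iter f (i + r) z ≡ x
    reachesX = begin
      iter f (i + r) z      ≡⟨ iter-+ f i r z ⟩
      iter f r (iter f i z) ≡⟨ cong (iter f r) fi≡fj ⟩
      iter f r (iter f j z) ≡⟨ iter-+ f j r z ⟨
      iter f (j + r) z      ≡⟨ cong (λ k → iter f k z) j+r≡m ⟩
      iter f m z            ≡⟨ ends ch ⟩
      x                     ∎
      where open ≡-Reasoning

  -- By pigeonhole, a chain ending outside C has at most |C| points in C.
  chain-bound : ∀ {z m x} → x ∉ C → Chain z m x → m ≤ length C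
  chain-bound {z} {m} x∉C ch with m ≤? length C
  ... | yes m≤ = m≤
  ... | no m≰ =
    let i , j , i<j , sameIndex = pigeonhole (≰⇒> m≰) (λ i → index (member i)) in
    ⊥-elim (chain-injective x∉C ch (toℕ i) (toℕ j) i<j (toℕ<n j)
      (index-injective (setoid Var) (member i) (member j) sameIndex))
    where
    member : (i : Fin m) → iter f (toℕ i) z ∈ C
    member i = inside ch (toℕ i) (toℕ<n i)

  -- Invariant: the walk is at the start w of a chain of
  -- length d and has k = |C| ∸ d fuel left; running out of fuel would give a
  -- chain longer than |C|.
  walkBack-start : ∀ {x} → x ∉ C → ∀ k w d → d + k ≡ length C → Chain w d x →
    Σ ℕ λ e → Chain (walkBack f C k w) e x × NoPreimage f C (walkBack f C k w)
  walkBack-start x∉C zero w d d+0≡ ch = d , ch , λ c c∈C fc≡w →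
    1+n≰n (subst (suc d ≤_) (trans (sym d+0≡) (+-identityʳ d))
      (chain-bound x∉C (extend c ch c∈C fc≡w)))
  walkBack-start x∉C (suc k) w d d+k≡ ch with preimageIn f C w in e
  ... | nothing = d , ch , preimageIn-complete f C w e
  ... | just c  = let c∈C , fc≡w = preimageIn-sound f C w e in
    walkBack-start x∉C k c (suc d) (trans (sym (+-suc d k)) d+k≡) (extend c ch c∈C fc≡w)

module InverseOn (f g : Var → Var) (C D : List Var)
  (D≡fC : D ≡ map f C) (gf : ∀ x → x ∈ C → g (f x) ≡ x) where
  open Chains f C

  f-into-D : ∀ x → x ∈ C → f x ∈ D
  f-into-D x x∈C = subst (f x ∈_) (sym D≡fC) (∈-map⁺ f x∈C)

  -- Every element of D is f d for some d ∈ C, on which g acts as the inverse.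
  g-into-C : ∀ c → c ∈ D → g c ∈ C
  g-into-C c c∈D with ∈-map⁻ f (subst (c ∈_) D≡fC c∈D)
  ... | d , d∈C , refl = subst (_∈ C) (sym (gf d d∈C)) d∈C

  g-preimage : ∀ c z → c ∈ D → g c ≡ z → c ≡ f z
  g-preimage c z c∈D gc≡z with ∈-map⁻ f (subst (c ∈_) D≡fC c∈D)
  ... | d , d∈C , refl = cong f (trans (sym (gf d d∈C)) gc≡z)

  walkForward : ∀ {x} → x ∉ C → ∀ m k z → m ≤ k → Chain z m x → walkBack g D k z ≡ x
  walkForward x∉C zero k z _ ch = trans (cong (walkBack g D k) (ends ch))
    (walkBack-stop g D k _ λ c c∈D gc≡x → x∉C (subst (_∈ C) gc≡x (g-into-C c c∈D)))
  walkForward x∉C (suc m) (suc k) z (s≤s m≤k) ch = trans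
    (walkBack-step g D k z (f z) (f-into-D z z∈C) (gf z z∈C)
      (λ c c∈D → g-preimage c z c∈D))
    (walkForward x∉C m k (f z) m≤k (tail ch))
    where
    z∈C : z ∈ C
    z∈C = head ch

module LeftInverse (α β : Prenaming) (D≡R : core β ≡ range α) (R′≡C : range β ≡ core α)
  (gf : ∀ x → x ∈ core α → fn β (fn α x) ≡ x) where
  open Chains (fn α) (core α)
  open InverseOn (fn α) (fn β) (core α) (core β) D≡R gf

  onCore : ∀ x → x ∈ core α → closure β (closure α x) ≡ x
  onCore x x∈C = begin
    closure β (closure α x) ≡⟨ cong (closure β) (closure-core α x x∈C) ⟩
    closure β (fn α x)      ≡⟨ closure-core β (fn α x) (f-into-D x x∈C) ⟩
    fn β (fn α x)           ≡⟨ gf x x∈C ⟩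
    x                       ∎
    where open ≡-Reasoning

  -- Outside C⁺(α) ∪ R⁺(α) = R⁺(β) ∪ C⁺(β) both closures are the identity.
  outside : ∀ x → x ∉ core α → x ∉ range α → closure β (closure α x) ≡ x
  outside x x∉C x∉R = trans (cong (closure β) (closure-outside α x x∉C x∉R))
    (closure-outside β x (λ x∈D → x∉R (subst (x ∈_) D≡R x∈D))
                         (λ x∈R′ → x∉C (subst (x ∈_) R′≡C x∈R′)))

  -- The start z of the maximal chain ending in x ∈ R⁺(α) ∖ C⁺(α) lies in
  -- R⁺(β) ∖ C⁺(β); the closure of β walks from z forwards along that chain to x.
  onRange : ∀ x → x ∉ core α → x ∈ range α → closure β (closure α x) ≡ x
  onRange x x∉C x∈R with walkBack-start x∉C (length (core α)) x 0 refl (trivialChain x)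
  ... | zero , ch , noPre with ∈-map⁻ (fn α) x∈R
  ...   | c , c∈C , x≡fc = ⊥-elim (noPre c c∈C (sym (trans (ends ch) x≡fc)))
  onRange x x∉C x∈R | suc e , ch , noPre = begin
    closure β (closure α x) ≡⟨ cong (closure β) (closure-range α x x∉C x∈R) ⟩
    closure β z             ≡⟨ closure-range β z z∉D z∈R′ ⟩
    walkBack (fn β) (core β) (length (core β)) z
      ≡⟨ walkForward x∉C (suc e) _ z (subst (suc e ≤_) (sym |D|≡|C|) (chain-bound x∉C ch)) ch ⟩
    x                       ∎
    where
    open ≡-Reasoning
    z : Var
    z = walkBack (fn α) (core α) (length (core α)) x
    z∉D : z ∉ core β
    z∉D z∈D with ∈-map⁻ (fn α) (subst (z ∈_) D≡R z∈D)
    ... | c , c∈C , z≡fc = noPre c c∈C (sym z≡fc)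
    z∈R′ : z ∈ range β
    z∈R′ = subst (z ∈_) (sym R′≡C) (head ch)
    |D|≡|C| : length (core β) ≡ length (core α)
    |D|≡|C| = trans (cong length D≡R) (length-map (fn α) (core α))

  closure-leftInverse : ∀ x → closure β (closure α x) ≡ x
  closure-leftInverse x = byCases (x ∈? core α) (x ∈? range α)
    where
    byCases : Dec (x ∈ core α) → Dec (x ∈ range α) → closure β (closure α x) ≡ x
    byCases (yes x∈C) _         = onCore x x∈C
    byCases (no x∉C)  (no x∉R)  = outside x x∉C x∉R
    byCases (no x∉C)  (yes x∈R) = onRange x x∉C x∈R

map-leftInverse : ∀ (f g : Var → Var) C → (∀ x → x ∈ C → g (f x) ≡ x) → map g (map f C) ≡ C
map-leftInverse f g []      gf = refl
map-leftInverse f g (c ∷ C) gf =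
  cong₂ _∷_ (gf c (here refl)) (map-leftInverse f g C (λ x x∈C → gf x (there x∈C)))

mainTheorem11 : (α αinv : Prenaming)
    → core αinv ≡ map (fn α) (core α)
    → (∀ x → x ∈ core α → fn αinv (fn α x) ≡ x)
    → ∀ x → closure αinv (closure α x) ≡ x × closure α (closure αinv x) ≡ x
mainTheorem11 α β D≡R gf x =
  LeftInverse.closure-leftInverse α β D≡R R′≡C gf x ,
  LeftInverse.closure-leftInverse β α (sym R′≡C) (sym D≡R) fg x
  where
  -- R⁺(αinv) = αinv(α(C⁺(α))) = C⁺(α)
  R′≡C : range β ≡ core α
  R′≡C = trans (cong (map (fn β)) D≡R) (map-leftInverse (fn α) (fn β) (core α) gf)
  -- α ∘ αinv = id on C⁺(αinv), since every y ∈ C⁺(αinv) is α d with d ∈ C⁺(α).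
  fg : ∀ y → y ∈ core β → fn α (fn β y) ≡ y
  fg y y∈D with ∈-map⁻ (fn α) (subst (y ∈_) D≡R y∈D)
  ... | d , d∈C , refl = cong (fn α) (gf d d∈C)
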